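{- For every $m\ge 0$, \begin{align*} \Delta_m\Delta_{m-1}\cdots\Delta_0(\widetilde{\alpha}'_k(x))=\sum_{\ell=m}^k q^{(k-\ell)m+\binom{\ell}{2}}\genfrac{[}{]}{0pt}{}{k-m}{\ell-m}_q \alpha_\ell x^\ell. \end{align*}
   Context: The $q$-Pochhammer symbol is $(A;q)_N:=\prod_{k=0}^{N-1}(1-Aq^k)$, and the $q$-binomial coefficient is $\genfrac{[}{]}{0pt}{}{n}{k}_q:=\frac{(q;q)_n}{(q;q)_k(q;q)_{n-k}}$ for $0\le k\le n$ and $0$ otherwise. Let $(\alpha_k)_{k\ge0}$ be an arbitrary sequence, and define for each $k\ge0$ \begin{align*} \widetilde{\alpha}'_k(x) := \sum_{\ell=0}^{k}q^{\binom{\ell}{2}}\genfrac{[}{]}{0pt}{}{k}{\ell}_{q}\alpha_{\ell}x^{\ell}. \end{align*} For arbitrary sequences $(s_k)_{k\ge0}$ (indexed by $k$), define the operators $\Delta_0(s_k):=s_k$ and $\Delta_i(s_k):=s_k-q^{i-1}s_{k-1}$ for $i\ge1$. -}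

module Defs where

open import Level using (Level)
open import Data.Nat as ℕ using (ℕ; zero; suc)
open import Data.Nat.Combinatorics using (_C_)
open import Algebra.Bundles using (CommutativeRing)

-- All objects live in an arbitrary commutative ring R (q, x, α_ℓ are
-- elements of R; the identity is a polynomial identity).
module _ {c ℓ : Level} (R : CommutativeRing c ℓ) where
  open CommutativeRing R using (Carrier; _+_; _*_; -_; 0#; 1#)

  minus : Carrier → Carrier → Carrier
  minus a b = a + (- b)

  pow : Carrier → ℕ → Carrier
  pow a zero    = 1#
  pow a (suc n) = a * pow a n

  sumBelow : ℕ → (ℕ → Carrier) → Carrier
  sumBelow zero    f = 0#
  sumBelow (suc n) f = sumBelow n f + f n

  -- Σ_{ℓ=a}^{b} f ℓ  (empty, i.e. 0, when b < a)
  sumFromTo : ℕ → ℕ → (ℕ → Carrier) → Carrier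
  sumFromTo a b f = sumBelow (suc b ℕ.∸ a) (λ i → f (a ℕ.+ i))

  -- Gaussian binomial coefficient [n choose k]_q, as a polynomial in q
  -- (q-Pascal recurrence); equals (q;q)_n / ((q;q)_k (q;q)_{n-k}) for
  -- 0 ≤ k ≤ n and is 0 for k > n.
  qbinom : Carrier → ℕ → ℕ → Carrier
  qbinom q zero    zero    = 1#
  qbinom q zero    (suc k) = 0#
  qbinom q (suc n) zero    = 1#
  qbinom q (suc n) (suc k) = qbinom q n k + pow q (suc k) * qbinom q n (suc k)

  alphaTilde : Carrier → (ℕ → Carrier) → Carrier → ℕ → Carrier
  alphaTilde q α x k =
    sumFromTo 0 k (λ l → pow q (l C 2) * qbinom q k l * α l * pow x l)

  -- Δ_i on sequences s = (s_k)_{k ≥ 0}; Δ_0 s = s,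
  -- Δ_i s_k = s_k - q^{i-1} s_{k-1} (i ≥ 1), with the convention s_{-1} = 0.
  Δ : Carrier → ℕ → (ℕ → Carrier) → (ℕ → Carrier)
  Δ q zero    s k       = s k
  Δ q (suc i) s zero    = s zero
  Δ q (suc i) s (suc k) = minus (s (suc k)) (pow q i * s k)

  Δs : Carrier → ℕ → (ℕ → Carrier) → (ℕ → Carrier)
  Δs q zero    s = Δ q zero s
  Δs q (suc m) s = Δ q (suc m) (Δs q m s)

{-# OPTIONS --safe #-}
module Submission where

open import Defs
open import Level using (Level)
open import Data.Nat as ℕ using (ℕ; zero; suc; _≤_; _<_; _∸_; _≤?_)
open import Data.Nat.Combinatorics using (_C_)
import Data.Nat.Properties as ℕₚ
open import Data.Product using (_,_)
open import Relation.Nullary using (yes; no)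
open import Function using (_∘_)
open import Relation.Binary.PropositionalEquality as ≡ using (_≡_)
open import Algebra.Bundles using (CommutativeRing)

-- Write k = m + n and ℓ = m + i, and induct on m.  Besides their defining
-- recurrence, the q-binomials satisfy the second q-Pascal rule
-- [n+1, i+1] = q^(n-i) [n, i] + [n, i+1].  By it, the i-th summand for
-- (m, n+1) is the i-th summand for (m+1, n) plus q^m times the (i+1)-st summand
-- for (m, n).  Summing over i, the right-hand side R_m satisfies
-- R_m(k+1) = R_(m+1)(k+1) + q^m R_m(k), that is, Δ_(m+1) R_m = R_(m+1).

module _ {c ℓ : Level} (R : CommutativeRing c ℓ) where
  open CommutativeRing R
  open import Algebra.Properties.Ring ring using (//-rightDividesʳ)
  open import Algebra.Properties.CommutativeSemigroup +-commutativeSemigroup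
    using (interchange)
  open import Algebra.Solver.Ring.NaturalCoefficients.Default commutativeSemiring
    using (solve; con; _:+_; _:*_; _:=_)
  open import Relation.Binary.Reasoning.Setoid setoid

  pow-+ : ∀ a m n → pow R a (m ℕ.+ n) ≈ pow R a m * pow R a n
  pow-+ a zero    n = sym (*-identityˡ _)
  pow-+ a (suc m) n = trans (*-congˡ (pow-+ a m n)) (sym (*-assoc _ _ _))

  sumBelow-cong : ∀ N {f g : ℕ → Carrier} →
                  (∀ i → f i ≈ g i) → sumBelow R N f ≈ sumBelow R N g
  sumBelow-cong zero    f≈g = refl
  sumBelow-cong (suc N) f≈g = +-cong (sumBelow-cong N f≈g) (f≈g N)

  *-distribˡ-sumBelow : ∀ a N (f : ℕ → Carrier) →
                        a * sumBelow R N f ≈ sumBelow R N (λ i → a * f i)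
  *-distribˡ-sumBelow a zero    f = zeroʳ a
  *-distribˡ-sumBelow a (suc N) f =
    trans (distribˡ a _ _) (+-congʳ (*-distribˡ-sumBelow a N f))

  sumBelow-+-shifted : ∀ N {h u v : ℕ → Carrier} →
                       h 0 ≈ v 0 → (∀ i → h (suc i) ≈ u i + v (suc i)) →
                       sumBelow R (suc N) h ≈ sumBelow R N u + sumBelow R (suc N) v
  sumBelow-+-shifted zero    h₀ hₛ = +-congˡ (trans h₀ (sym (+-identityˡ _)))
  sumBelow-+-shifted (suc N) h₀ hₛ =
    trans (+-cong (sumBelow-+-shifted N h₀ hₛ) (hₛ N)) (interchange _ _ _ _)

  sumFromTo-+ : ∀ a n (f : ℕ → Carrier) →
                sumFromTo R a (a ℕ.+ n) f ≡ sumBelow R (suc n) (λ i → f (a ℕ.+ i))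
  sumFromTo-+ a n f = ≡.cong (λ N → sumBelow R N (λ i → f (a ℕ.+ i))) length
    where
    length : suc (a ℕ.+ n) ∸ a ≡ suc n
    length = ≡.trans (≡.cong (_∸ a) (≡.sym (ℕₚ.+-suc a n))) (ℕₚ.m+n∸m≡n a (suc n))

  module _ (q : Carrier) where

    qbinom[n,0]≈1 : ∀ n → qbinom R q n 0 ≈ 1#
    qbinom[n,0]≈1 zero    = refl
    qbinom[n,0]≈1 (suc n) = refl

    n<k⇒qbinom[n,k]≈0 : ∀ {n k} → n < k → qbinom R q n k ≈ 0#
    n<k⇒qbinom[n,k]≈0 {zero}  {suc k} _ = refl
    n<k⇒qbinom[n,k]≈0 {suc n} {suc k} (ℕ.s≤s n<k) = begin
      qbinom R q n k + pow R q (suc k) * qbinom R q n (suc k)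
        ≈⟨ +-cong (n<k⇒qbinom[n,k]≈0 n<k)
                  (*-congˡ (n<k⇒qbinom[n,k]≈0 (ℕₚ.m<n⇒m<1+n n<k))) ⟩
      0# + pow R q (suc k) * 0#
        ≈⟨ trans (+-identityˡ _) (zeroʳ _) ⟩
      0# ∎

    pow-*-qbinom-cong : ∀ {a b} n k → (k ≤ n → a ≡ b) →
                        pow R q a * qbinom R q n k ≈ pow R q b * qbinom R q n k
    pow-*-qbinom-cong n k a≡b with k ≤? n
    ... | yes k≤n = reflexive (≡.cong (λ e → pow R q e * qbinom R q n k) (a≡b k≤n))
    ... | no  k≰n = trans (annihilated _) (sym (annihilated _))
      where
      annihilated : ∀ a → a * qbinom R q n k ≈ 0#
      annihilated a = trans (*-congˡ (n<k⇒qbinom[n,k]≈0 (ℕₚ.≰⇒> k≰n))) (zeroʳ a)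

    qbinom-pascal′ : ∀ n k → qbinom R q (suc n) (suc k)
                            ≈ pow R q (n ∸ k) * qbinom R q n k + qbinom R q n (suc k)
    qbinom-pascal′ zero k =
      trans (+-congˡ (zeroʳ _))
            (+-congʳ (trans (sym (*-identityˡ _))
                            (*-congʳ (reflexive (≡.cong (pow R q) (≡.sym (ℕₚ.0∸n≡0 k)))))))
    qbinom-pascal′ (suc n) zero = begin
      1# + q * 1# * (B n 0 + q * 1# * B n 1)
        ≈⟨ +-congˡ (*-congˡ (trans (qbinom-pascal′ n 0)
                                   (+-congʳ (*-congˡ (qbinom[n,0]≈1 n))))) ⟩
      1# + q * 1# * (pow R q n * 1# + B n 1)
        ≈⟨ solve 3 (λ q p b → con 1 :+ q :* con 1 :* (p :* con 1 :+ b)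
                             := q :* p :* con 1 :+ (con 1 :+ q :* con 1 :* b))
                   refl q (pow R q n) (B n 1) ⟩
      q * pow R q n * 1# + (1# + q * 1# * B n 1)
        ≈⟨ +-congˡ (+-congʳ (sym (qbinom[n,0]≈1 n))) ⟩
      q * pow R q n * 1# + (B n 0 + q * 1# * B n 1) ∎
      where
      B : ℕ → ℕ → Carrier
      B = qbinom R q
    qbinom-pascal′ (suc n) (suc k) = begin
      B (suc n) (suc k) + Q₂ * B (suc n) (suc (suc k))
        ≈⟨ +-cong (qbinom-pascal′ n k) (*-congˡ (qbinom-pascal′ n (suc k))) ⟩
      (P₀ * B n k + B n (suc k)) + Q₂ * (P₁ * B n (suc k) + B n (suc (suc k)))
        ≈⟨ +-congˡ (trans (distribˡ Q₂ _ _) (+-congʳ exchange)) ⟩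
      (P₀ * B n k + B n (suc k)) + (P₀ * (Q₁ * B n (suc k)) + Q₂ * B n (suc (suc k)))
        ≈⟨ solve 5 (λ p b b′ r t → (p :* b :+ b′) :+ (p :* r :+ t)
                                  := p :* (b :+ r) :+ (b′ :+ t))
                   refl P₀ (B n k) (B n (suc k)) (Q₁ * B n (suc k)) (Q₂ * B n (suc (suc k))) ⟩
      P₀ * (B n k + Q₁ * B n (suc k)) + (B n (suc k) + Q₂ * B n (suc (suc k))) ∎
      where
      B : ℕ → ℕ → Carrier
      B = qbinom R q
      P₀ P₁ Q₁ Q₂ : Carrier
      P₀ = pow R q (n ∸ k)
      P₁ = pow R q (n ∸ suc k)
      Q₁ = pow R q (suc k)
      Q₂ = pow R q (suc (suc k))
      exponents : suc k ≤ n → suc (suc k) ℕ.+ (n ∸ suc k) ≡ (n ∸ k) ℕ.+ suc k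
      exponents k<n = ≡.trans (≡.cong suc (ℕₚ.+-comm (suc k) (n ∸ suc k)))
                              (≡.cong (ℕ._+ suc k) (≡.sym (ℕₚ.+-∸-assoc 1 k<n)))
      exchange : Q₂ * (P₁ * B n (suc k)) ≈ P₀ * (Q₁ * B n (suc k))
      exchange = begin
        Q₂ * (P₁ * B n (suc k))
          ≈⟨ sym (*-assoc _ _ _) ⟩
        Q₂ * P₁ * B n (suc k)
          ≈⟨ *-congʳ (sym (pow-+ q (suc (suc k)) (n ∸ suc k))) ⟩
        pow R q (suc (suc k) ℕ.+ (n ∸ suc k)) * B n (suc k)
          ≈⟨ pow-*-qbinom-cong n (suc k) exponents ⟩
        pow R q ((n ∸ k) ℕ.+ suc k) * B n (suc k)
          ≈⟨ *-congʳ (pow-+ q (n ∸ k) (suc k)) ⟩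
        P₀ * Q₁ * B n (suc k)
          ≈⟨ *-assoc _ _ _ ⟩
        P₀ * (Q₁ * B n (suc k)) ∎

    module _ (x : Carrier) (α : ℕ → Carrier) where

      term : ℕ → ℕ → ℕ → ℕ → Carrier
      term e n j l = pow R q e * qbinom R q n j * α l * pow R x l

      pow-*-term : ∀ a e n j l → pow R q a * term e n j l ≈ term (a ℕ.+ e) n j l
      pow-*-term a e n j l = begin
        pow R q a * (pow R q e * qbinom R q n j * α l * pow R x l)
          ≈⟨ solve 5 (λ a e b c d → a :* (e :* b :* c :* d) := a :* e :* b :* c :* d)
                     refl (pow R q a) (pow R q e) (qbinom R q n j) (α l) (pow R x l) ⟩
        pow R q a * pow R q e * qbinom R q n j * α l * pow R x l
          ≈⟨ *-congʳ (*-congʳ (*-congʳ (sym (pow-+ q a e)))) ⟩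
        term (a ℕ.+ e) n j l ∎

      term-exponent-cong : ∀ {e e′} n j l → (j ≤ n → e ≡ e′) →
                           term e n j l ≈ term e′ n j l
      term-exponent-cong n j l e≡e′ = *-congʳ (*-congʳ (pow-*-qbinom-cong n j e≡e′))

      n<j⇒term≈0 : ∀ e n j l → n < j → term e n j l ≈ 0#
      n<j⇒term≈0 e n j l n<j = begin
        pow R q e * qbinom R q n j * α l * pow R x l
          ≈⟨ *-congʳ (*-congʳ (*-congˡ (n<k⇒qbinom[n,k]≈0 n<j))) ⟩
        pow R q e * 0# * α l * pow R x l
          ≈⟨ trans (*-congʳ (trans (*-congʳ (zeroʳ _)) (zeroˡ _))) (zeroˡ _) ⟩
        0# ∎

      term-suc-zero : ∀ e n l → term e (suc n) 0 l ≈ term e n 0 l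
      term-suc-zero e n l = *-congʳ (*-congʳ (*-congˡ (sym (qbinom[n,0]≈1 n))))

      term-pascal′ : ∀ e n j l → term e (suc n) (suc j) l
                                 ≈ pow R q (n ∸ j) * term e n j l + term e n (suc j) l
      term-pascal′ e n j l = begin
        P * qbinom R q (suc n) (suc j) * α l * pow R x l
          ≈⟨ *-congʳ (*-congʳ (*-congˡ (qbinom-pascal′ n j))) ⟩
        P * (Q * qbinom R q n j + qbinom R q n (suc j)) * α l * pow R x l
          ≈⟨ solve 6 (λ p r b b′ a y → p :* (r :* b :+ b′) :* a :* y
                                       := r :* (p :* b :* a :* y) :+ p :* b′ :* a :* y)
                     refl P Q (qbinom R q n j) (qbinom R q n (suc j)) (α l) (pow R x l) ⟩
        Q * term e n j l + term e n (suc j) l ∎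
        where
        P Q : Carrier
        P = pow R q e
        Q = pow R q (n ∸ j)

      -- summand m n i is the ℓ = m + i summand of the right-hand side for k = m + n.
      summand : ℕ → ℕ → ℕ → Carrier
      summand m n i = term ((n ∸ i) ℕ.* m ℕ.+ (m ℕ.+ i) C 2) n i (m ℕ.+ i)

      summand-suc-zero : ∀ m n → summand m (suc n) 0 ≈ pow R q m * summand m n 0
      summand-suc-zero m n = begin
        term (suc n ℕ.* m ℕ.+ t) (suc n) 0 l
          ≈⟨ term-suc-zero (suc n ℕ.* m ℕ.+ t) n l ⟩
        term (suc n ℕ.* m ℕ.+ t) n 0 l
          ≡⟨ ≡.cong (λ e → term e n 0 l) (ℕₚ.+-assoc m (n ℕ.* m) t) ⟩
        term (m ℕ.+ (n ℕ.* m ℕ.+ t)) n 0 l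
          ≈⟨ sym (pow-*-term m (n ℕ.* m ℕ.+ t) n 0 l) ⟩
        pow R q m * summand m n 0 ∎
        where
        l t : ℕ
        l = m ℕ.+ 0
        t = l C 2

      summand-suc-suc : ∀ m n i →
        summand m (suc n) (suc i) ≈ summand (suc m) n i + pow R q m * summand m n (suc i)
      summand-suc-suc m n i = begin
        term e (suc n) (suc i) l
          ≈⟨ term-pascal′ e n i l ⟩
        pow R q d * term e n i l + term e n (suc i) l
          ≈⟨ +-cong (pow-*-term d e n i l) (term-exponent-cong n (suc i) l exponent) ⟩
        term (d ℕ.+ e) n i l + term (m ℕ.+ e′) n (suc i) l
          ≡⟨ ≡.cong₂ (λ e l′ → term e n i l′ + term (m ℕ.+ e′) n (suc i) l)
                     sum-exponent (ℕₚ.+-suc m i) ⟩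
        summand (suc m) n i + term (m ℕ.+ e′) n (suc i) l
          ≈⟨ +-congˡ (sym (pow-*-term m e′ n (suc i) l)) ⟩
        summand (suc m) n i + pow R q m * summand m n (suc i) ∎
        where
        d l e e′ : ℕ
        d = n ∸ i
        l = m ℕ.+ suc i
        e = d ℕ.* m ℕ.+ l C 2
        e′ = (n ∸ suc i) ℕ.* m ℕ.+ l C 2
        sum-exponent : d ℕ.+ e ≡ d ℕ.* suc m ℕ.+ (suc m ℕ.+ i) C 2
        sum-exponent = ≡.trans (≡.sym (ℕₚ.+-assoc d (d ℕ.* m) (l C 2)))
                               (≡.cong₂ ℕ._+_ (≡.sym (ℕₚ.*-suc d m))
                                              (≡.cong (_C 2) (ℕₚ.+-suc m i)))
        exponent : suc i ≤ n → e ≡ m ℕ.+ e′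
        exponent i<n = ≡.trans (≡.cong (λ d → d ℕ.* m ℕ.+ l C 2) (ℕₚ.+-∸-assoc 1 i<n))
                               (ℕₚ.+-assoc m ((n ∸ suc i) ℕ.* m) (l C 2))

      summand-vanishes : ∀ m n → summand m n (suc n) ≈ 0#
      summand-vanishes m n =
        n<j⇒term≈0 ((n ∸ suc n) ℕ.* m ℕ.+ (m ℕ.+ suc n) C 2) n (suc n) (m ℕ.+ suc n)
                   ℕₚ.≤-refl

      sumBelow-summand-suc : ∀ m n →
        sumBelow R (suc (suc n)) (summand m (suc n))
          ≈ sumBelow R (suc n) (summand (suc m) n)
            + pow R q m * sumBelow R (suc n) (summand m n)
      sumBelow-summand-suc m n = begin
        S (suc (suc n)) (summand m (suc n))
          ≈⟨ sumBelow-+-shifted (suc n) (summand-suc-zero m n) (summand-suc-suc m n) ⟩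
        S (suc n) (summand (suc m) n) + S (suc (suc n)) (λ i → pow R q m * summand m n i)
          ≈⟨ +-congˡ (+-congˡ (trans (*-congˡ (summand-vanishes m n)) (zeroʳ _))) ⟩
        S (suc n) (summand (suc m) n) + (S (suc n) (λ i → pow R q m * summand m n i) + 0#)
          ≈⟨ +-congˡ (trans (+-identityʳ _)
                            (sym (*-distribˡ-sumBelow (pow R q m) (suc n) (summand m n)))) ⟩
        S (suc n) (summand (suc m) n) + pow R q m * S (suc n) (summand m n) ∎
        where
        S : ℕ → (ℕ → Carrier) → Carrier
        S = sumBelow R

      Δs-alphaTilde : ∀ m n → Δs R q m (alphaTilde R q α x) (m ℕ.+ n)
                               ≈ sumBelow R (suc n) (summand m n)
      Δs-alphaTilde zero    n = sumBelow-cong (suc n) λ i →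
        reflexive (≡.cong (λ d → term (d ℕ.+ i C 2) n i i) (≡.sym (ℕₚ.*-zeroʳ (n ∸ i))))
      Δs-alphaTilde (suc m) n = begin
        minus R (D (suc (m ℕ.+ n))) (pow R q m * D (m ℕ.+ n))
          ≈⟨ +-cong (trans (reflexive (≡.cong D (≡.sym (ℕₚ.+-suc m n))))
                           (Δs-alphaTilde m (suc n)))
                    (-‿cong (*-congˡ (Δs-alphaTilde m n))) ⟩
        minus R (S (suc (suc n)) (summand m (suc n))) Z
          ≈⟨ +-congʳ (sumBelow-summand-suc m n) ⟩
        minus R (S (suc n) (summand (suc m) n) + Z) Z
          ≈⟨ //-rightDividesʳ Z _ ⟩
        S (suc n) (summand (suc m) n) ∎
        where
        D : ℕ → Carrier
        D = Δs R q m (alphaTilde R q α x)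
        S : ℕ → (ℕ → Carrier) → Carrier
        S = sumBelow R
        Z : Carrier
        Z = pow R q m * S (suc n) (summand m n)

      Δs-alphaTilde-sumFromTo : ∀ m n →
        Δs R q m (alphaTilde R q α x) (m ℕ.+ n)
          ≈ sumFromTo R m (m ℕ.+ n) (λ l →
              term ((m ℕ.+ n ∸ l) ℕ.* m ℕ.+ l C 2) (m ℕ.+ n ∸ m) (l ∸ m) l)
      Δs-alphaTilde-sumFromTo m n = begin
        Δs R q m (alphaTilde R q α x) (m ℕ.+ n)  ≈⟨ Δs-alphaTilde m n ⟩
        sumBelow R (suc n) (summand m n)         ≈⟨ sumBelow-cong (suc n) (reflexive ∘ reindex) ⟩
        sumBelow R (suc n) (λ i → F (m ℕ.+ i))   ≡⟨ ≡.sym (sumFromTo-+ m n F) ⟩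
        sumFromTo R m (m ℕ.+ n) F                ∎
        where
        F : ℕ → Carrier
        F l = term ((m ℕ.+ n ∸ l) ℕ.* m ℕ.+ l C 2) (m ℕ.+ n ∸ m) (l ∸ m) l
        reindex : ∀ i → summand m n i ≡ F (m ℕ.+ i)
        reindex i rewrite ℕₚ.[m+n]∸[m+o]≡n∸o m n i
                        | ℕₚ.m+n∸m≡n m n
                        | ℕₚ.m+n∸m≡n m i = ≡.refl

lemma4p2 : ∀ {c ℓ : Level} (R : CommutativeRing c ℓ) →
    let open CommutativeRing R in
    (q x : Carrier) (α : ℕ → Carrier) (m k : ℕ) → m ≤ k →
    Δs R q m (alphaTilde R q α x) k
      ≈ sumFromTo R m k (λ l →
          pow R q ((k ℕ.∸ l) ℕ.* m ℕ.+ l C 2)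
            * qbinom R q (k ℕ.∸ m) (l ℕ.∸ m) * α l * pow R x l)
lemma4p2 R q x α m k m≤k with ℕₚ.m≤n⇒∃[o]m+o≡n m≤k
... | n , ≡.refl = Δs-alphaTilde-sumFromTo R q x α m n
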